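{- Let $m,k,r$ be integers with either $k\ge1$, $q^{k-1}\le r<q^k\le q^m$, or $(r,k)=(0,0)$ and $m\ge0$. Then for all $x\in\mathbf F_q[[T]]$, $$\Delta_{r,m}(x)^{q^m}=\phi_r(x)-\sum_{\substack{k\le i\le m-1\\ 1\le j\le q-1}}T^{jq^i}\phi_{jq^i+r}(x).$$
   Context: $q$ is a power of a prime. $\Delta_{r,m}(\sum_{n\ge0}x_nT^n)=\sum_{n\ge0}x_{nq^m+r}T^n$ for $0\le r<q^m$. For $n\ge1$ with $q^{k'-1}\le n<q^{k'}$, $\phi_n(\sum_{i\ge0}x_iT^i)=\sum_{i\ge0}x_{iq^{k'}+n}T^{iq^{k'}}$; $\phi_0$ is the identity. -}

module Defs where

open import Level using (Level)
open import Data.Nat as ℕ using (ℕ; zero; suc; _≤_; _<_; _<ᵇ_; _∸_)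
open import Data.Nat.Primality using (Prime)
open import Data.Fin using (Fin)
open import Data.List using (List; []; _∷_; foldr; map; concatMap)
open import Data.Bool using (if_then_else_)
open import Data.Product using (Σ; _×_; ∃)
open import Relation.Nullary using (¬_)
open import Relation.Binary.PropositionalEquality using (_≡_)
open import Algebra.Bundles using (CommutativeRing)

IsPrimePower : ℕ → Set
IsPrimePower q = Σ ℕ λ p → Σ ℕ λ e → Prime p × 1 ≤ e × q ≡ p ℕ.^ e

record IsFiniteFieldOfSize {c ℓ : Level} (R : CommutativeRing c ℓ) (q : ℕ) : Set (c Level.⊔ ℓ) where
  open CommutativeRing R
  field
    nontrivial : ¬ (1# ≈ 0#)
    inverse    : ∀ x → ¬ (x ≈ 0#) → Σ Carrier λ y → x * y ≈ 1#
    enum       : Fin q → Carrier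
    enum-inj   : ∀ i j → enum i ≈ enum j → i ≡ j
    enum-surj  : ∀ x → Σ (Fin q) λ i → enum i ≈ x

range : ℕ → ℕ → List ℕ
range a b = go a (b ∸ a)
  where
  go : ℕ → ℕ → List ℕ
  go a zero = []
  go a (suc n) = a ∷ go (suc a) n

-- k' = number of base-q digits of n: the least k with n < q^k
-- (so q^(k-1) ≤ n < q^k for n ≥ 1, and 0 for n = 0)
ndigits : ℕ → ℕ → ℕ
ndigits q n = go 0 (suc n)
  where
  go : ℕ → ℕ → ℕ
  go k zero = k
  go k (suc f) = if n <ᵇ q ℕ.^ k then k else go (suc k) f

module PowerSeries {c ℓ : Level} (R : CommutativeRing c ℓ) where
  open CommutativeRing R

  PS : Set c
  PS = ℕ → Carrier

  _≈ₚ_ : PS → PS → Set ℓ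
  f ≈ₚ g = ∀ n → f n ≈ g n

  ΣR : List Carrier → Carrier
  ΣR = foldr _+_ 0#

  _+ₚ_ : PS → PS → PS
  (f +ₚ g) n = f n + g n

  _-ₚ_ : PS → PS → PS
  (f -ₚ g) n = f n - g n

  0ₚ : PS
  0ₚ _ = 0#

  _*ₚ_ : PS → PS → PS
  (f *ₚ g) n = ΣR (map (λ i → f i * g (n ∸ i)) (range 0 (suc n)))

  1ₚ : PS
  1ₚ zero = 1#
  1ₚ (suc _) = 0#

  _^ₚ_ : PS → ℕ → PS
  f ^ₚ zero = 1ₚ
  f ^ₚ suc n = f *ₚ (f ^ₚ n)

  Tᵖ : ℕ → PS
  Tᵖ n i = if ℕ._≡ᵇ_ i n then 1# else 0#

  ΣPS : List PS → PS
  ΣPS = foldr _+ₚ_ 0ₚ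

  Δ : (q r m : ℕ) → PS → PS
  Δ q r m x n = x (n ℕ.* q ℕ.^ m ℕ.+ r)

  -- φ_n(Σ x_i T^i) = Σ x_{i q^{k'} + n} T^{i q^{k'}}, where q^{k'-1} ≤ n < q^{k'};
  -- φ_0 = identity
  φ : (q n : ℕ) → PS → PS
  φ q zero x = x
  φ q n@(suc _) x t =
    ΣR (map (λ i → if ℕ._≡ᵇ_ (i ℕ.* Q) t then x (i ℕ.* Q ℕ.+ n) else 0#) (range 0 (suc t)))
    where
    Q : ℕ
    Q = q ℕ.^ ndigits q n

-- Over F_q the q^m-th power is additive on power series (Frobenius, from the binomial theorem in
-- characteristic p) and fixes every coefficient (a ^ q ≈ a), so the coefficient of T^t in
-- Δ_{r,m}(x)^{q^m} is x_{t+r} when q^m ∣ t and 0 otherwise. On the other side, the coefficient of T^t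
-- in φ_n(x) is x_{t+n} when q^{k′} ∣ t and 0 otherwise, where k′ is the number of base-q digits of n.
-- Hence T^{j q^i} φ_{j q^i + r}(x) contributes x_{t+r} exactly when q^i ∣ t and the i-th digit of t
-- is j; summing over 1 ≤ j < q gives ([q^i ∣ t] - [q^{i+1} ∣ t]) x_{t+r}, the sum over k ≤ i < m
-- telescopes to ([q^k ∣ t] - [q^m ∣ t]) x_{t+r}, and φ_r(x) contributes [q^k ∣ t] x_{t+r}.

module Submission where

open import Defs
open import Level using (Level)
open import Data.Bool using (true; false; if_then_else_)
open import Data.Nat as ℕ using (ℕ; zero; suc; _≤_; _<_; _∸_; z≤n; s≤s; NonZero)
import Data.Nat.Properties as ℕ
open import Data.Nat.Combinatorics using (_C_; nCk+nC[k+1]≡[n+1]C[k+1]; nC1≡n; nCn≡1)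
open import Data.Nat.DivMod using (_%_; _/_; m≡m%n+[m/n]*n; [m+kn]%n≡m%n; m<n⇒m%n≡m; m%n<n)
open import Data.Nat.Divisibility
  using (_∣_; _∣?_; divides; 1∣_; ∣-refl; ∣-trans; n∣m*n; >⇒∤; *-cancelʳ-∣; *-monoˡ-∣; m%n≡0⇒n∣m; n∣m⇒m%n≡0)
open import Data.Nat.Primality using (Prime; euclidsLemma; prime⇒nonZero; prime⇒nonTrivial)
open import Data.Fin as Fin using (Fin; toℕ; inject₁; fromℕ; punchIn)
import Data.Fin.Properties as Fin
open import Data.Fin.Permutation using (Permutation; permutation; _⟨$⟩ʳ_)
open import Data.List using (List; []; _∷_; _++_; map; concatMap)
open import Data.List.Properties using (map-∘; map-cong)
open import Data.Product using (_,_; proj₁; proj₂)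
open import Data.Sum using (_⊎_; inj₁; inj₂)
open import Relation.Nullary using (Dec; yes; no; ¬_; contradiction)
open import Relation.Binary.Definitions using (Decidable)
open import Relation.Binary.PropositionalEquality as ≡ using (_≡_; _≢_)
open import Algebra.Bundles using (CommutativeMonoid; CommutativeSemiring; CommutativeRing)
open import Algebra.Structures using (IsCommutativeSemiring)
import Algebra.Properties.Group

module _ where
  open import Data.Nat
  open import Data.Nat.Properties
  open import Data.Product using (_×_)
  open import Relation.Binary.PropositionalEquality

  range-self : ∀ a → range a a ≡ []
  range-self a rewrite n∸n≡0 a = refl

  range-suc : ∀ a n → range a (a + suc n) ≡ a ∷ range (suc a) (suc a + n)
  range-suc a n rewrite m+n∸m≡n a (suc n) | m+n∸m≡n (suc a) n = refl

  range-map-suc : ∀ a n → range (suc a) (suc a + n) ≡ map suc (range a (a + n))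
  range-map-suc a zero rewrite +-identityʳ a = trans (range-self (suc a)) (cong (map suc) (sym (range-self a)))
  range-map-suc a (suc n) = begin
    range (suc a) (suc a + suc n)                ≡⟨ range-suc (suc a) n ⟩
    suc a ∷ range (2 + a) (2 + a + n)            ≡⟨ cong (suc a ∷_) (range-map-suc (suc a) n) ⟩
    suc a ∷ map suc (range (suc a) (suc a + n))  ≡⟨ cong (map suc) (range-suc a n) ⟨
    map suc (range a (a + suc n))                ∎
    where open ≡-Reasoning

  n<q^n : ∀ {q} → 1 < q → ∀ n → n < q ^ n
  n<q^n 1<q zero = z<s
  n<q^n {q} 1<q (suc n) =
    ≤-<-trans (n<q^n 1<q n) (<-≤-trans (m<m*n (q ^ n) q 1<q) (≤-reflexive (*-comm (q ^ n) q)))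
    where instance _ = m^n≢0 q n {{>-nonZero (<-trans z<s 1<q)}}

  digitsFrom : ℕ → ℕ → ℕ → ℕ → ℕ
  digitsFrom q n k zero = k
  digitsFrom q n k (suc fuel) = if n <ᵇ q ^ k then k else digitsFrom q n (suc k) fuel

  ndigits≡digitsFrom : ∀ q n → ndigits q n ≡ digitsFrom q n 0 (suc n)
  ndigits≡digitsFrom q zero = refl
  ndigits≡digitsFrom q (suc n) =
    trans (unfold-once q n) (cong (if suc n <ᵇ q ^ 1 then 1 else_) (loop≡digitsFrom q (suc n) 2 n))
    where
    -- The loop in the definition of ndigits is local to it, so it is named here by unification;
    -- one iteration is unfolded first because q ^ 0 already normalises to 1.
    loop : ℕ → ℕ → ℕ → ℕ → ℕ
    loop = _

    unfold-once : ∀ q n → ndigits q (suc n) ≡ (if suc n <ᵇ q ^ 1 then 1 else loop q (suc n) 2 n)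
    unfold-once q n with suc n
    ... | m with 2
    ... | k with n
    ... | fuel = refl

    loop≡digitsFrom : ∀ q n k fuel → loop q n k fuel ≡ digitsFrom q n k fuel
    loop≡digitsFrom q n k zero = refl
    loop≡digitsFrom q n k (suc fuel) = cong (if n <ᵇ q ^ k then k else_) (loop≡digitsFrom q n (suc k) fuel)

  ndigits≡suc : ∀ {q} → 1 < q → ∀ {n D} → q ^ D ≤ n → n < q ^ suc D → ndigits q n ≡ suc D
  ndigits≡suc {q} 1<q {n} {D} q^D≤n n<q^1+D =
    trans (ndigits≡digitsFrom q n) (digitsFrom-stops 0 (suc n) z≤n (s≤s (<-≤-trans (n<q^n 1<q D) q^D≤n)))
    where
    instance _ = >-nonZero (<-trans z<s 1<q)

    digitsFrom-stops : ∀ k fuel → k ≤ suc D → suc D < k + fuel → digitsFrom q n k fuel ≡ suc D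
    digitsFrom-stops k zero k≤1+D 1+D<k+0 =
      contradiction (≤-trans 1+D<k+0 (≤-reflexive (+-identityʳ k))) (<⇒≱ (s≤s k≤1+D))
    digitsFrom-stops k (suc fuel) k≤1+D 1+D<k+fuel with m≤n⇒m<n∨m≡n k≤1+D
    ... | inj₂ refl with n <ᵇ q ^ suc D | <⇒<ᵇ n<q^1+D
    ...   | true | _ = refl
    digitsFrom-stops k (suc fuel) k≤1+D 1+D<k+fuel | inj₁ (s≤s k≤D) with n <ᵇ q ^ k | <ᵇ⇒< n (q ^ k)
    ...   | true  | n<q^k = contradiction (≤-trans (^-monoʳ-≤ q k≤D) q^D≤n) (<⇒≱ (n<q^k _))
    ...   | false | _     =
      digitsFrom-stops (suc k) fuel (s≤s k≤D) (≤-trans 1+D<k+fuel (≤-reflexive (+-suc k fuel)))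

  [k+1]*[n+1]C[k+1]≡[n+1]*nCk : ∀ n k → suc k * (suc n C suc k) ≡ suc n * (n C k)
  [k+1]*[n+1]C[k+1]≡[n+1]*nCk zero zero = refl
  [k+1]*[n+1]C[k+1]≡[n+1]*nCk zero (suc k) = *-zeroʳ (2 + k)
  [k+1]*[n+1]C[k+1]≡[n+1]*nCk (suc n) zero =
    trans (+-identityʳ _) (trans (nC1≡n (2 + n)) (sym (*-identityʳ (2 + n))))
  [k+1]*[n+1]C[k+1]≡[n+1]*nCk (suc n) (suc k) = begin
    (2 + k) * ((2 + n) C (2 + k))       ≡⟨ cong ((2 + k) *_) (nCk+nC[k+1]≡[n+1]C[k+1] (suc n) (suc k)) ⟨
    (2 + k) * (a + b)                   ≡⟨ *-distribˡ-+ (2 + k) a b ⟩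
    a + (1 + k) * a + (2 + k) * b       ≡⟨ cong₂ (λ u v → a + u + v) ([k+1]*[n+1]C[k+1]≡[n+1]*nCk n k)
                                                                      ([k+1]*[n+1]C[k+1]≡[n+1]*nCk n (suc k)) ⟩
    a + (1 + n) * c + (1 + n) * d       ≡⟨ +-assoc a _ _ ⟩
    a + ((1 + n) * c + (1 + n) * d)     ≡⟨ cong (a +_) (*-distribˡ-+ (1 + n) c d) ⟨
    a + (1 + n) * (c + d)               ≡⟨ cong (λ u → a + (1 + n) * u) (nCk+nC[k+1]≡[n+1]C[k+1] n k) ⟩
    (2 + n) * a                         ∎
    where
    open ≡-Reasoning
    a = (1 + n) C (1 + k)
    b = (1 + n) C (2 + k)
    c = n C k
    d = n C (1 + k)

  prime∣nCk : ∀ {p k} → Prime p → 0 < k → k < p → p ∣ p C k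
  prime∣nCk {suc p} {suc k} p-prime _ k<p with euclidsLemma (suc k) (suc p C suc k) p-prime
    (divides (p C k) (trans ([k+1]*[n+1]C[k+1]≡[n+1]*nCk p k) (*-comm (suc p) (p C k))))
  ... | inj₁ p∣1+k = contradiction p∣1+k (>⇒∤ k<p)
  ... | inj₂ p∣pCk = p∣pCk

  module _ {A q : ℕ} .{{_ : NonZero A}} .{{_ : NonZero q}} where

    digitForm : ∀ j l → j * A + l * (q * A) ≡ (j + l * q) * A
    digitForm j l = sym (trans (*-distribʳ-+ A j (l * q)) (cong (j * A +_) (*-assoc l q A)))

    ∣-digitForm : ∀ j l → A ∣ j * A + l * (q * A)
    ∣-digitForm j l = divides (j + l * q) (digitForm j l)

    digitForm⇒%≡ : ∀ {u j l} → j < q → u * A ≡ j * A + l * (q * A) → u % q ≡ j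
    digitForm⇒%≡ {u} {j} {l} j<q uA≡ = begin
      u % q           ≡⟨ cong (_% q) (*-cancelʳ-≡ u (j + l * q) A (trans uA≡ (digitForm j l))) ⟩
      (j + l * q) % q ≡⟨ [m+kn]%n≡m%n j l q ⟩
      j % q           ≡⟨ m<n⇒m%n≡m j<q ⟩
      j               ∎
      where open ≡-Reasoning

    *≡digitForm : ∀ u → u * A ≡ (u % q) * A + (u / q) * (q * A)
    *≡digitForm u = trans (cong (_* A) (m≡m%n+[m/n]*n u q)) (sym (digitForm (u % q) (u / q)))

  primePower>1 : ∀ {q} → IsPrimePower q → 1 < q
  primePower>1 (p , suc e , p-prime , _ , refl) =
    <-≤-trans (nonTrivial⇒n>1 p {{prime⇒nonTrivial p-prime}}) (m≤m*n p (p ^ e) {{m^n≢0 p e}})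
    where instance _ = prime⇒nonZero p-prime

  hypothesis⇒ndigits : ∀ {q m k r} → 1 < q →
                       (1 ≤ k × q ^ (k ∸ 1) ≤ r × r < q ^ k × q ^ k ≤ q ^ m) ⊎ (r ≡ 0 × k ≡ 0) →
                       ndigits q r ≡ k × r < q ^ k × k ≤ m
  hypothesis⇒ndigits {q} {m} {suc k} 1<q (inj₁ (_ , q^k≤r , r<q^[1+k] , q^[1+k]≤q^m)) =
    ndigits≡suc 1<q q^k≤r r<q^[1+k] , r<q^[1+k] , ≮⇒≥ λ m<1+k → <⇒≱ (^-monoʳ-< q 1<q m<1+k) q^[1+k]≤q^m
  hypothesis⇒ndigits 1<q (inj₂ (refl , refl)) = refl , s≤s z≤n , z≤n

module RangeSums {c ℓ : Level} (R : CommutativeRing c ℓ) where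
  open CommutativeRing R
  open PowerSeries R using (ΣR)
  open import Relation.Binary.Reasoning.Setoid setoid

  private
    <-+-suc : ∀ {a n i} → i < suc a ℕ.+ n → i < a ℕ.+ suc n
    <-+-suc {a} {n} {i} = ≡.subst (i <_) (≡.sym (ℕ.+-suc a n))

    ΣR-range+-zero : ∀ (h : ℕ → Carrier) a n → (∀ i → a ≤ i → i < a ℕ.+ n → h i ≈ 0#) →
                     ΣR (map h (range a (a ℕ.+ n))) ≈ 0#
    ΣR-range+-zero h a zero _ rewrite ℕ.+-identityʳ a | range-self a = refl
    ΣR-range+-zero h a (suc n) h≈0 rewrite range-suc a n =
      trans (+-cong (h≈0 a ℕ.≤-refl (ℕ.m<m+n a ℕ.z<s))
                    (ΣR-range+-zero h (suc a) n λ i a<i i< → h≈0 i (ℕ.<⇒≤ a<i) (<-+-suc i<)))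
            (+-identityʳ 0#)

    ΣR-range+-single : ∀ (h : ℕ → Carrier) a n j → a ≤ j → j < a ℕ.+ n →
                       (∀ i → a ≤ i → i < a ℕ.+ n → i ≢ j → h i ≈ 0#) → ΣR (map h (range a (a ℕ.+ n))) ≈ h j
    ΣR-range+-single h a zero j a≤j j<a+0 _ =
      contradiction (ℕ.≤-trans j<a+0 (ℕ.≤-reflexive (ℕ.+-identityʳ a))) (ℕ.<⇒≱ (s≤s a≤j))
    ΣR-range+-single h a (suc n) j a≤j j<a+1+n h≈0 rewrite range-suc a n with a ℕ.≟ j
    ... | yes ≡.refl = trans (+-congˡ (ΣR-range+-zero h (suc a) n λ i a<i i< →
                                         h≈0 i (ℕ.<⇒≤ a<i) (<-+-suc i<) λ i≡a → ℕ.<-irrefl (≡.sym i≡a) a<i))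
                             (+-identityʳ (h a))
    ... | no a≢j = trans (+-cong (h≈0 a ℕ.≤-refl (ℕ.m<m+n a ℕ.z<s) a≢j)
                                 (ΣR-range+-single h (suc a) n j (ℕ.≤∧≢⇒< a≤j a≢j)
                                    (≡.subst (j <_) (ℕ.+-suc a n) j<a+1+n)
                                    λ i a<i i< → h≈0 i (ℕ.<⇒≤ a<i) (<-+-suc i<)))
                         (+-identityˡ (h j))

    ΣR-range+-telescope : ∀ (g d : ℕ → Carrier) a n → (∀ i → a ≤ i → i < a ℕ.+ n → g i + d (suc i) ≈ d i) →
                          ΣR (map g (range a (a ℕ.+ n))) + d (a ℕ.+ n) ≈ d a
    ΣR-range+-telescope g d a zero _ rewrite ℕ.+-identityʳ a | range-self a = +-identityˡ (d a)
    ΣR-range+-telescope g d a (suc n) step rewrite range-suc a n | ℕ.+-suc a n = begin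
      (g a + ΣR (map g (range (suc a) (suc a ℕ.+ n)))) + d (suc a ℕ.+ n) ≈⟨ +-assoc _ _ _ ⟩
      g a + (ΣR (map g (range (suc a) (suc a ℕ.+ n))) + d (suc a ℕ.+ n)) ≈⟨ +-congˡ (ΣR-range+-telescope g d (suc a) n
                                                                            λ i a<i i< → step i (ℕ.<⇒≤ a<i) i<) ⟩
      g a + d (suc a)                                                     ≈⟨ step a ℕ.≤-refl (s≤s (ℕ.m≤m+n a n)) ⟩
      d a                                                                 ∎

  ΣR-range-zero : ∀ (h : ℕ → Carrier) a b → (∀ i → a ≤ i → i < b → h i ≈ 0#) → ΣR (map h (range a b)) ≈ 0#
  ΣR-range-zero h a b h≈0 with ℕ.≤-total a b
  ... | inj₂ b≤a rewrite ℕ.m≤n⇒m∸n≡0 b≤a = refl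
  ... | inj₁ a≤b with ℕ.m≤n⇒∃[o]m+o≡n a≤b
  ...   | n , ≡.refl = ΣR-range+-zero h a n h≈0

  ΣR-range-single : ∀ (h : ℕ → Carrier) a b j → a ≤ j → j < b → (∀ i → a ≤ i → i < b → i ≢ j → h i ≈ 0#) →
                    ΣR (map h (range a b)) ≈ h j
  ΣR-range-single h a b j a≤j j<b with ℕ.m≤n⇒∃[o]m+o≡n (ℕ.≤-trans a≤j (ℕ.<⇒≤ j<b))
  ... | n , ≡.refl = ΣR-range+-single h a n j a≤j j<b

  ΣR-telescope : ∀ (g d : ℕ → Carrier) a b → a ≤ b → (∀ i → a ≤ i → i < b → g i + d (suc i) ≈ d i) →
                 ΣR (map g (range a b)) + d b ≈ d a
  ΣR-telescope g d a b a≤b with ℕ.m≤n⇒∃[o]m+o≡n a≤b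
  ... | n , ≡.refl = ΣR-range+-telescope g d a n

module PowerSeriesSemiring {c ℓ : Level} (R : CommutativeRing c ℓ) where
  open CommutativeRing R
  open PowerSeries R
  open import Algebra.Properties.CommutativeSemigroup +-commutativeSemigroup using (interchange; x∙yz≈y∙xz)
  open import Relation.Binary.Reasoning.Setoid setoid

  tailₚ : PS → PS
  tailₚ f n = f (suc n)

  _·ₚ_ : Carrier → PS → PS
  (a ·ₚ f) n = a * f n

  *ₚ-coeff-zero : ∀ f g → (f *ₚ g) 0 ≈ f 0 * g 0
  *ₚ-coeff-zero f g = +-identityʳ _

  *ₚ-coeff-suc : ∀ f g n → (f *ₚ g) (suc n) ≈ f 0 * g (suc n) + (tailₚ f *ₚ g) n
  *ₚ-coeff-suc f g n = +-congˡ (reflexive (≡.cong ΣR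
    (≡.trans (≡.cong (map h) (range-map-suc 0 (suc n))) (≡.sym (map-∘ (range 0 (suc n)))))))
    where
    h : ℕ → Carrier
    h i = f i * g (suc n ∸ i)

  *ₚ-coeff-sucʳ : ∀ f g n → (f *ₚ g) (suc n) ≈ f (suc n) * g 0 + (f *ₚ tailₚ g) n
  *ₚ-coeff-sucʳ f g zero = begin
    (f *ₚ g) 1                  ≈⟨ *ₚ-coeff-suc f g 0 ⟩
    f 0 * g 1 + (tailₚ f *ₚ g) 0 ≈⟨ +-congˡ (*ₚ-coeff-zero (tailₚ f) g) ⟩
    f 0 * g 1 + f 1 * g 0        ≈⟨ +-comm _ _ ⟩
    f 1 * g 0 + f 0 * g 1        ≈⟨ +-congˡ (*ₚ-coeff-zero f (tailₚ g)) ⟨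
    f 1 * g 0 + (f *ₚ tailₚ g) 0 ∎
  *ₚ-coeff-sucʳ f g (suc n) = begin
    (f *ₚ g) (2 ℕ.+ n)                                              ≈⟨ *ₚ-coeff-suc f g (suc n) ⟩
    f 0 * g (2 ℕ.+ n) + (tailₚ f *ₚ g) (suc n)                      ≈⟨ +-congˡ (*ₚ-coeff-sucʳ (tailₚ f) g n) ⟩
    f 0 * g (2 ℕ.+ n) + (f (2 ℕ.+ n) * g 0 + (tailₚ f *ₚ tailₚ g) n) ≈⟨ x∙yz≈y∙xz _ _ _ ⟩
    f (2 ℕ.+ n) * g 0 + (f 0 * g (2 ℕ.+ n) + (tailₚ f *ₚ tailₚ g) n) ≈⟨ +-congˡ (*ₚ-coeff-suc f (tailₚ g) n) ⟨
    f (2 ℕ.+ n) * g 0 + (f *ₚ tailₚ g) (suc n)                      ∎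

  *ₚ-cong : ∀ {f f′ g g′} → f ≈ₚ f′ → g ≈ₚ g′ → (f *ₚ g) ≈ₚ (f′ *ₚ g′)
  *ₚ-cong {f} {f′} {g} {g′} f≈f′ g≈g′ zero = begin
    (f *ₚ g) 0     ≈⟨ *ₚ-coeff-zero f g ⟩
    f 0 * g 0      ≈⟨ *-cong (f≈f′ 0) (g≈g′ 0) ⟩
    f′ 0 * g′ 0    ≈⟨ *ₚ-coeff-zero f′ g′ ⟨
    (f′ *ₚ g′) 0   ∎
  *ₚ-cong {f} {f′} {g} {g′} f≈f′ g≈g′ (suc n) = begin
    (f *ₚ g) (suc n)                       ≈⟨ *ₚ-coeff-suc f g n ⟩
    f 0 * g (suc n) + (tailₚ f *ₚ g) n
      ≈⟨ +-cong (*-cong (f≈f′ 0) (g≈g′ (suc n))) (*ₚ-cong (λ i → f≈f′ (suc i)) g≈g′ n) ⟩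
    f′ 0 * g′ (suc n) + (tailₚ f′ *ₚ g′) n ≈⟨ *ₚ-coeff-suc f′ g′ n ⟨
    (f′ *ₚ g′) (suc n)                     ∎

  *ₚ-comm : ∀ f g → (f *ₚ g) ≈ₚ (g *ₚ f)
  *ₚ-comm f g zero = trans (*ₚ-coeff-zero f g) (trans (*-comm _ _) (sym (*ₚ-coeff-zero g f)))
  *ₚ-comm f g (suc n) = begin
    (f *ₚ g) (suc n)                   ≈⟨ *ₚ-coeff-suc f g n ⟩
    f 0 * g (suc n) + (tailₚ f *ₚ g) n ≈⟨ +-cong (*-comm _ _) (*ₚ-comm (tailₚ f) g n) ⟩
    g (suc n) * f 0 + (g *ₚ tailₚ f) n ≈⟨ *ₚ-coeff-sucʳ g f n ⟨
    (g *ₚ f) (suc n)                   ∎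

  *ₚ-zeroˡ : ∀ f → (0ₚ *ₚ f) ≈ₚ 0ₚ
  *ₚ-zeroˡ f zero = trans (*ₚ-coeff-zero 0ₚ f) (zeroˡ _)
  *ₚ-zeroˡ f (suc n) = trans (*ₚ-coeff-suc 0ₚ f n) (trans (+-cong (zeroˡ _) (*ₚ-zeroˡ f n)) (+-identityʳ _))

  *ₚ-identityˡ : ∀ f → (1ₚ *ₚ f) ≈ₚ f
  *ₚ-identityˡ f zero = trans (*ₚ-coeff-zero 1ₚ f) (*-identityˡ _)
  *ₚ-identityˡ f (suc n) = trans (*ₚ-coeff-suc 1ₚ f n) (trans (+-cong (*-identityˡ _) (*ₚ-zeroˡ f n)) (+-identityʳ _))

  *ₚ-distribʳ : ∀ h f g → ((f +ₚ g) *ₚ h) ≈ₚ ((f *ₚ h) +ₚ (g *ₚ h))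
  *ₚ-distribʳ h f g zero = trans (*ₚ-coeff-zero (f +ₚ g) h)
    (trans (distribʳ _ _ _) (sym (+-cong (*ₚ-coeff-zero f h) (*ₚ-coeff-zero g h))))
  *ₚ-distribʳ h f g (suc n) = begin
    ((f +ₚ g) *ₚ h) (suc n)
      ≈⟨ *ₚ-coeff-suc (f +ₚ g) h n ⟩
    (f 0 + g 0) * h (suc n) + ((tailₚ f +ₚ tailₚ g) *ₚ h) n
      ≈⟨ +-cong (distribʳ _ _ _) (*ₚ-distribʳ h (tailₚ f) (tailₚ g) n) ⟩
    (f 0 * h (suc n) + g 0 * h (suc n)) + ((tailₚ f *ₚ h) n + (tailₚ g *ₚ h) n)
      ≈⟨ interchange _ _ _ _ ⟩
    (f 0 * h (suc n) + (tailₚ f *ₚ h) n) + (g 0 * h (suc n) + (tailₚ g *ₚ h) n)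
      ≈⟨ +-cong (*ₚ-coeff-suc f h n) (*ₚ-coeff-suc g h n) ⟨
    ((f *ₚ h) +ₚ (g *ₚ h)) (suc n)
      ∎

  ·ₚ-*ₚ-assoc : ∀ a f g → ((a ·ₚ f) *ₚ g) ≈ₚ (a ·ₚ (f *ₚ g))
  ·ₚ-*ₚ-assoc a f g zero = trans (*ₚ-coeff-zero (a ·ₚ f) g) (trans (*-assoc _ _ _) (*-congˡ (sym (*ₚ-coeff-zero f g))))
  ·ₚ-*ₚ-assoc a f g (suc n) = begin
    ((a ·ₚ f) *ₚ g) (suc n)                        ≈⟨ *ₚ-coeff-suc (a ·ₚ f) g n ⟩
    a * f 0 * g (suc n) + ((a ·ₚ tailₚ f) *ₚ g) n  ≈⟨ +-cong (*-assoc _ _ _) (·ₚ-*ₚ-assoc a (tailₚ f) g n) ⟩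
    a * (f 0 * g (suc n)) + a * (tailₚ f *ₚ g) n   ≈⟨ distribˡ _ _ _ ⟨
    a * (f 0 * g (suc n) + (tailₚ f *ₚ g) n)       ≈⟨ *-congˡ (*ₚ-coeff-suc f g n) ⟨
    (a ·ₚ (f *ₚ g)) (suc n)                        ∎

  *ₚ-assoc : ∀ f g h → ((f *ₚ g) *ₚ h) ≈ₚ (f *ₚ (g *ₚ h))
  *ₚ-assoc f g h zero = begin
    ((f *ₚ g) *ₚ h) 0   ≈⟨ trans (*ₚ-coeff-zero (f *ₚ g) h) (*-congʳ (*ₚ-coeff-zero f g)) ⟩
    f 0 * g 0 * h 0     ≈⟨ *-assoc _ _ _ ⟩
    f 0 * (g 0 * h 0)   ≈⟨ trans (*ₚ-coeff-zero f (g *ₚ h)) (*-congˡ (*ₚ-coeff-zero g h)) ⟨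
    (f *ₚ (g *ₚ h)) 0   ∎
  *ₚ-assoc f g h (suc n) = begin
    ((f *ₚ g) *ₚ h) (suc n)                                             ≈⟨ *ₚ-coeff-suc (f *ₚ g) h n ⟩
    (f *ₚ g) 0 * h (suc n) + (tailₚ (f *ₚ g) *ₚ h) n
      ≈⟨ +-cong (*-congʳ (*ₚ-coeff-zero f g)) (*ₚ-cong {g = h} (*ₚ-coeff-suc f g) (λ _ → refl) n) ⟩
    f 0 * g 0 * h (suc n) + (((f 0 ·ₚ tailₚ g) +ₚ (tailₚ f *ₚ g)) *ₚ h) n ≈⟨ +-congˡ (*ₚ-distribʳ h _ _ n) ⟩
    f 0 * g 0 * h (suc n) + (((f 0 ·ₚ tailₚ g) *ₚ h) n + ((tailₚ f *ₚ g) *ₚ h) n)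
      ≈⟨ +-cong (*-assoc _ _ _) (+-cong (·ₚ-*ₚ-assoc (f 0) (tailₚ g) h n) (*ₚ-assoc (tailₚ f) g h n)) ⟩
    f 0 * (g 0 * h (suc n)) + (f 0 * (tailₚ g *ₚ h) n + (tailₚ f *ₚ (g *ₚ h)) n) ≈⟨ +-assoc _ _ _ ⟨
    (f 0 * (g 0 * h (suc n)) + f 0 * (tailₚ g *ₚ h) n) + (tailₚ f *ₚ (g *ₚ h)) n ≈⟨ +-congʳ (distribˡ _ _ _) ⟨
    f 0 * (g 0 * h (suc n) + (tailₚ g *ₚ h) n) + (tailₚ f *ₚ (g *ₚ h)) n  ≈⟨ +-congʳ (*-congˡ (*ₚ-coeff-suc g h n)) ⟨
    f 0 * (g *ₚ h) (suc n) + (tailₚ f *ₚ (g *ₚ h)) n                      ≈⟨ *ₚ-coeff-suc f (g *ₚ h) n ⟨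
    (f *ₚ (g *ₚ h)) (suc n)                                              ∎

  isCommutativeSemiringₚ : IsCommutativeSemiring _≈ₚ_ _+ₚ_ _*ₚ_ 0ₚ 1ₚ
  isCommutativeSemiringₚ = record
    { isSemiring = record
      { isSemiringWithoutAnnihilatingZero = record
        { +-isCommutativeMonoid = record
          { isMonoid = record
            { isSemigroup = record
              { isMagma = record
                { isEquivalence = record
                  { refl = λ _ → refl ; sym = λ f≈g n → sym (f≈g n) ; trans = λ f≈g g≈h n → trans (f≈g n) (g≈h n) }
                ; ∙-cong = λ f≈f′ g≈g′ n → +-cong (f≈f′ n) (g≈g′ n) }
              ; assoc = λ f g h n → +-assoc (f n) (g n) (h n) }
            ; identity = (λ f n → +-identityˡ (f n)) , (λ f n → +-identityʳ (f n)) }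
          ; comm = λ f g n → +-comm (f n) (g n) }
        ; *-cong = *ₚ-cong
        ; *-assoc = *ₚ-assoc
        ; *-identity = *ₚ-identityˡ , λ f n → trans (*ₚ-comm f 1ₚ n) (*ₚ-identityˡ f n)
        ; distrib = (λ h f g n → trans (*ₚ-comm h (f +ₚ g) n)
                                   (trans (*ₚ-distribʳ h f g n) (+-cong (*ₚ-comm f h n) (*ₚ-comm g h n))))
                  , *ₚ-distribʳ }
      ; zero = *ₚ-zeroˡ , λ f n → trans (*ₚ-comm f 0ₚ n) (*ₚ-zeroˡ f n) }
    ; *-comm = *ₚ-comm }

  commutativeSemiringₚ : CommutativeSemiring c ℓ
  commutativeSemiringₚ = record { isCommutativeSemiring = isCommutativeSemiringₚ }

  private
    module Sₚ = CommutativeSemiring commutativeSemiringₚ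
  open import Algebra.Properties.CommutativeSemiring.Exp commutativeSemiringₚ as Expₚ using ()

  ^ₚ≈^ : ∀ f n → (f ^ₚ n) ≈ₚ (f Expₚ.^ n)
  ^ₚ≈^ f zero _ = refl
  ^ₚ≈^ f (suc n) = *ₚ-cong {f} (λ _ → refl) (^ₚ≈^ f n)

  ^ₚ-congˡ : ∀ n {f g} → f ≈ₚ g → (f ^ₚ n) ≈ₚ (g ^ₚ n)
  ^ₚ-congˡ n {f} {g} f≈g = Sₚ.trans (^ₚ≈^ f n) (Sₚ.trans (Expₚ.^-congˡ n f≈g) (Sₚ.sym (^ₚ≈^ g n)))

  ^ₚ-assocʳ : ∀ f m n → ((f ^ₚ m) ^ₚ n) ≈ₚ (f ^ₚ (m ℕ.* n))
  ^ₚ-assocʳ f m n = Sₚ.trans (^ₚ≈^ (f ^ₚ m) n) (Sₚ.trans (Expₚ.^-congˡ n (^ₚ≈^ f m))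
                      (Sₚ.trans (Expₚ.^-assocʳ f m n) (Sₚ.sym (^ₚ≈^ f (m ℕ.* n)))))

  ^ₚ-distrib-*ₚ : ∀ f g n → ((f *ₚ g) ^ₚ n) ≈ₚ ((f ^ₚ n) *ₚ (g ^ₚ n))
  ^ₚ-distrib-*ₚ f g n = Sₚ.trans (^ₚ≈^ (f *ₚ g) n) (Sₚ.trans (Expₚ.^-distrib-* f g n)
                          (Sₚ.sym (*ₚ-cong (^ₚ≈^ f n) (^ₚ≈^ g n))))

module PowerSeriesCoefficients {c ℓ : Level} (R : CommutativeRing c ℓ) where
  open CommutativeRing R
  open PowerSeries R
  open PowerSeriesSemiring R
  open RangeSums R
  open import Relation.Binary.Reasoning.Setoid setoid

  ΣPS-coeff-map : ∀ (g : ℕ → PS) L t → ΣPS (map g L) t ≡ ΣR (map (λ i → g i t) L)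
  ΣPS-coeff-map g [] t = ≡.refl
  ΣPS-coeff-map g (i ∷ L) t = ≡.cong (g i t +_) (ΣPS-coeff-map g L t)

  ΣPS-coeff-++ : ∀ fs gs t → ΣPS (fs ++ gs) t ≈ ΣPS fs t + ΣPS gs t
  ΣPS-coeff-++ [] gs t = sym (+-identityˡ _)
  ΣPS-coeff-++ (f ∷ fs) gs t = trans (+-congˡ (ΣPS-coeff-++ fs gs t)) (sym (+-assoc _ _ _))

  ΣPS-coeff-concatMap : ∀ (g : ℕ → List PS) L t → ΣPS (concatMap g L) t ≈ ΣR (map (λ i → ΣPS (g i) t) L)
  ΣPS-coeff-concatMap g [] t = refl
  ΣPS-coeff-concatMap g (i ∷ L) t = trans (ΣPS-coeff-++ (g i) (concatMap g L) t) (+-congˡ (ΣPS-coeff-concatMap g L t))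

  Tᵖ-*ₚ-coeff-+ : ∀ s g u → (Tᵖ s *ₚ g) (s ℕ.+ u) ≈ g u
  Tᵖ-*ₚ-coeff-+ zero g u = trans (*ₚ-cong {g = g} Tᵖ0≈1ₚ (λ _ → refl) u) (*ₚ-identityˡ g u)
    where
    Tᵖ0≈1ₚ : Tᵖ 0 ≈ₚ 1ₚ
    Tᵖ0≈1ₚ zero = refl
    Tᵖ0≈1ₚ (suc _) = refl
  Tᵖ-*ₚ-coeff-+ (suc s) g u =
    trans (*ₚ-coeff-suc (Tᵖ (suc s)) g (s ℕ.+ u))
          (trans (+-congʳ (zeroˡ _)) (trans (+-identityˡ _) (Tᵖ-*ₚ-coeff-+ s g u)))

  Tᵖ-*ₚ-coeff-< : ∀ s g t → t < s → (Tᵖ s *ₚ g) t ≈ 0#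
  Tᵖ-*ₚ-coeff-< (suc s) g zero _ = trans (*ₚ-coeff-zero (Tᵖ (suc s)) g) (zeroˡ _)
  Tᵖ-*ₚ-coeff-< (suc s) g (suc t) (s≤s t<s) =
    trans (*ₚ-coeff-suc (Tᵖ (suc s)) g t)
          (trans (+-congʳ (zeroˡ _)) (trans (+-identityˡ _) (Tᵖ-*ₚ-coeff-< s g t t<s)))

  𝟙 : ∀ {p} {P : Set p} → Dec P → Carrier
  𝟙 (yes _) = 1#
  𝟙 (no _) = 0#

  𝟙-yes : ∀ {p} {P : Set p} (P? : Dec P) → P → 𝟙 P? ≈ 1#
  𝟙-yes (yes _) _ = refl
  𝟙-yes (no ¬P) P = contradiction P ¬P

  𝟙-no : ∀ {p} {P : Set p} (P? : Dec P) → ¬ P → 𝟙 P? ≈ 0#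
  𝟙-no (yes P) ¬P = contradiction P ¬P
  𝟙-no (no _) _ = refl

  private
    if-≡ᵇ-refl : ∀ n (a : Carrier) → (if n ℕ.≡ᵇ n then a else 0#) ≈ a
    if-≡ᵇ-refl n a with n ℕ.≡ᵇ n | ℕ.≡⇒≡ᵇ n n ≡.refl
    ... | true | _ = refl

    if-≡ᵇ-≢ : ∀ {m n} (a : Carrier) → m ≢ n → (if m ℕ.≡ᵇ n then a else 0#) ≈ 0#
    if-≡ᵇ-≢ {m} {n} a m≢n with m ℕ.≡ᵇ n | ℕ.≡ᵇ⇒≡ m n
    ... | true  | m≡n = contradiction (m≡n _) m≢n
    ... | false | _   = refl

  φ-coeff : ∀ q .{{_ : NonZero q}} n x t → φ q n x t ≈ 𝟙 (q ℕ.^ ndigits q n ∣? t) * x (t ℕ.+ n)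
  φ-coeff q zero x t with 1 ∣? t
  ... | yes _ = sym (trans (*-identityˡ _) (reflexive (≡.cong x (ℕ.+-identityʳ t))))
  ... | no 1∤t = contradiction (1∣ t) 1∤t
  φ-coeff q (suc n) x t with q ℕ.^ ndigits q (suc n) ∣? t
  ... | yes (divides l ≡.refl) = begin
    φ q (suc n) x (l ℕ.* Q) ≈⟨ ΣR-range-single (select (l ℕ.* Q)) 0 (suc (l ℕ.* Q)) l z≤n (s≤s (ℕ.m≤m*n l Q)) off-l ⟩
    select (l ℕ.* Q) l      ≈⟨ if-≡ᵇ-refl (l ℕ.* Q) _ ⟩
    x (l ℕ.* Q ℕ.+ suc n)   ≈⟨ *-identityˡ _ ⟨
    1# * x (l ℕ.* Q ℕ.+ suc n) ∎
    where
    Q = q ℕ.^ ndigits q (suc n)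
    instance _ = ℕ.m^n≢0 q (ndigits q (suc n))
    select : ℕ → ℕ → Carrier
    select t i = if i ℕ.* Q ℕ.≡ᵇ t then x (i ℕ.* Q ℕ.+ suc n) else 0#
    off-l : ∀ i → 0 ≤ i → i < suc (l ℕ.* Q) → i ≢ l → select (l ℕ.* Q) i ≈ 0#
    off-l i _ _ i≢l = if-≡ᵇ-≢ _ λ iQ≡lQ → i≢l (ℕ.*-cancelʳ-≡ i l Q iQ≡lQ)
  ... | no Q∤t = trans (ΣR-range-zero _ 0 (suc t) λ i _ _ → if-≡ᵇ-≢ _ λ iQ≡t → Q∤t (divides i (≡.sym iQ≡t)))
                       (sym (zeroˡ _))

module CharacteristicP {a ℓ : Level} (S : CommutativeSemiring a ℓ) where
  open CommutativeSemiring S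
  open import Algebra.Properties.Semiring.Mult semiring using (_×_; ×-congʳ; ×-assoc-*; ×1-homo-*)
  open import Algebra.Properties.Semiring.Exp semiring using (_^_)
  open import Algebra.Properties.Semiring.Sum semiring using (sum-init-last; sum-cong-≋; sum-replicate-zero)
  open import Algebra.Properties.CommutativeSemiring.Binomial S using (theorem; binomialTerm)
  open import Relation.Binary.Reasoning.Setoid setoid

  ×-char : ∀ {p} → p × 1# ≈ 0# → ∀ {m} x → p ∣ m → m × x ≈ 0#
  ×-char {p} char x (divides d ≡.refl) = begin
    (d ℕ.* p) × x                ≈⟨ ×-congʳ (d ℕ.* p) (*-identityˡ x) ⟨
    (d ℕ.* p) × (1# * x)         ≈⟨ ×-assoc-* (d ℕ.* p) 1# x ⟨
    ((d ℕ.* p) × 1#) * x         ≈⟨ *-congʳ (×1-homo-* d p) ⟩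
    ((d × 1#) * (p × 1#)) * x    ≈⟨ *-congʳ (*-congˡ char) ⟩
    ((d × 1#) * 0#) * x          ≈⟨ trans (*-congʳ (zeroʳ _)) (zeroˡ x) ⟩
    0#                           ∎

  -- The binomial coefficients strictly between the two ends are multiples of p.
  ^-char-+ : ∀ {p} → Prime p → p × 1# ≈ 0# → ∀ x y → (x + y) ^ p ≈ x ^ p + y ^ p
  ^-char-+ {suc p} p-prime char x y = begin
    (x + y) ^ suc p                                        ≈⟨ theorem (suc p) x y ⟩
    term Fin.zero + ∑ (λ i → term (Fin.suc i))             ≈⟨ +-congˡ (sum-init-last (λ i → term (Fin.suc i))) ⟩
    term Fin.zero + (∑ inner + term (Fin.suc (fromℕ p)))   ≈⟨ +-cong first (+-cong inner≈0 last) ⟩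
    y ^ suc p + (0# + x ^ suc p)                           ≈⟨ trans (+-congˡ (+-identityˡ _)) (+-comm _ _) ⟩
    x ^ suc p + y ^ suc p                                  ∎
    where
    open import Algebra.Properties.Semiring.Sum semiring using () renaming (sum to ∑)
    term = binomialTerm x y (suc p)
    inner : Fin p → Carrier
    inner i = term (Fin.suc (inject₁ i))
    first : term Fin.zero ≈ y ^ suc p
    first = trans (+-identityʳ _) (*-identityˡ _)
    last : term (Fin.suc (fromℕ p)) ≈ x ^ suc p
    last rewrite Fin.toℕ-fromℕ p | nCn≡1 (suc p) | ℕ.n∸n≡0 p = trans (+-identityʳ _) (*-identityʳ _)
    inner≈0 : ∑ inner ≈ 0#
    inner≈0 = trans (sum-cong-≋ λ i → ×-char char _ (prime∣nCk p-prime ℕ.z<s (s≤s (inner-bound i))))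
                    (sum-replicate-zero p)
      where
      inner-bound : (i : Fin p) → toℕ (inject₁ i) < p
      inner-bound i = ≡.subst (_< p) (≡.sym (Fin.toℕ-inject₁ i)) (Fin.toℕ<n i)

module PowerSeriesFrobenius {c ℓ : Level} (R : CommutativeRing c ℓ) where
  open CommutativeRing R
  open PowerSeries R
  open PowerSeriesSemiring R
  open PowerSeriesCoefficients R
  open import Algebra.Properties.Semiring.Mult semiring using (_×_)
  open import Algebra.Properties.Semiring.Exp semiring using (_^_; ^-congˡ; ^-assocʳ)
  open import Algebra.Properties.Semiring.Mult (CommutativeSemiring.semiring commutativeSemiringₚ)
    using () renaming (_×_ to _×ₚ_)
  open import Relation.Binary.Reasoning.Setoid setoid
  private
    module Sₚ = CommutativeSemiring commutativeSemiringₚ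

  ·ₚ1ₚ-coeff-pos : ∀ a t → 0 < t → (a ·ₚ 1ₚ) t ≈ 0#
  ·ₚ1ₚ-coeff-pos a (suc t) _ = zeroʳ a

  ·ₚ1ₚ-^ₚ : ∀ a n → ((a ·ₚ 1ₚ) ^ₚ n) ≈ₚ ((a ^ n) ·ₚ 1ₚ)
  ·ₚ1ₚ-^ₚ a zero t = sym (*-identityˡ (1ₚ t))
  ·ₚ1ₚ-^ₚ a (suc n) = Sₚ.trans (*ₚ-cong {a ·ₚ 1ₚ} Sₚ.refl (·ₚ1ₚ-^ₚ a n))
                        (Sₚ.trans (·ₚ-*ₚ-assoc a 1ₚ ((a ^ n) ·ₚ 1ₚ))
                          (λ t → trans (*-congˡ (*ₚ-identityˡ ((a ^ n) ·ₚ 1ₚ) t)) (sym (*-assoc _ _ _))))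

  Tᵖ1-^ₚ : ∀ n → (Tᵖ 1 ^ₚ n) ≈ₚ Tᵖ n
  Tᵖ1-^ₚ zero zero = refl
  Tᵖ1-^ₚ zero (suc t) = refl
  Tᵖ1-^ₚ (suc n) = Sₚ.trans (*ₚ-cong {Tᵖ 1} Sₚ.refl (Tᵖ1-^ₚ n)) Tᵖ1-*ₚ-Tᵖ
    where
    Tᵖ1-*ₚ-Tᵖ : (Tᵖ 1 *ₚ Tᵖ n) ≈ₚ Tᵖ (suc n)
    Tᵖ1-*ₚ-Tᵖ zero = Tᵖ-*ₚ-coeff-< 1 (Tᵖ n) 0 ℕ.z<s
    Tᵖ1-*ₚ-Tᵖ (suc t) = Tᵖ-*ₚ-coeff-+ 1 (Tᵖ n) t

  split-head : ∀ f → f ≈ₚ ((f 0 ·ₚ 1ₚ) +ₚ (Tᵖ 1 *ₚ tailₚ f))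
  split-head f zero = sym (trans (+-cong (*-identityʳ (f 0)) (Tᵖ-*ₚ-coeff-< 1 (tailₚ f) 0 ℕ.z<s)) (+-identityʳ (f 0)))
  split-head f (suc t) = sym (trans (+-cong (zeroʳ (f 0)) (Tᵖ-*ₚ-coeff-+ 1 (tailₚ f) t)) (+-identityˡ (f (suc t))))

  ×ₚ-coeff : ∀ m f t → (m ×ₚ f) t ≡ m × f t
  ×ₚ-coeff zero f t = ≡.refl
  ×ₚ-coeff (suc m) f t = ≡.cong (f t +_) (×ₚ-coeff m f t)

  module _ {p} (p-prime : Prime p) (char : p × 1# ≈ 0#) where
    private
      instance _ = prime⇒nonZero p-prime
      p>0 : 0 < p
      p>0 = ℕ.>-nonZero⁻¹ p

    ^ₚ-char-+ₚ : ∀ f g → ((f +ₚ g) ^ₚ p) ≈ₚ ((f ^ₚ p) +ₚ (g ^ₚ p))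
    ^ₚ-char-+ₚ f g = Sₚ.trans (^ₚ≈^ (f +ₚ g) p)
      (Sₚ.trans (CharacteristicP.^-char-+ commutativeSemiringₚ p-prime charₚ f g)
        (Sₚ.sym (Sₚ.+-cong (^ₚ≈^ f p) (^ₚ≈^ g p))))
      where
      open CharacteristicP commutativeSemiring using (×-char)
      charₚ : (p ×ₚ 1ₚ) ≈ₚ 0ₚ
      charₚ t = ≡.subst (_≈ 0#) (≡.sym (×ₚ-coeff p 1ₚ t)) (×-char {p} char (1ₚ t) ∣-refl)

    ^ₚ-char-split : ∀ f → (f ^ₚ p) ≈ₚ (((f 0 ^ p) ·ₚ 1ₚ) +ₚ (Tᵖ p *ₚ (tailₚ f ^ₚ p)))
    ^ₚ-char-split f =
      Sₚ.trans (^ₚ-congˡ p (split-head f))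
      (Sₚ.trans (^ₚ-char-+ₚ (f 0 ·ₚ 1ₚ) (Tᵖ 1 *ₚ tailₚ f))
      (Sₚ.+-cong (·ₚ1ₚ-^ₚ (f 0) p)
      (Sₚ.trans (^ₚ-distrib-*ₚ (Tᵖ 1) (tailₚ f) p)
                (*ₚ-cong {g = tailₚ f ^ₚ p} (Tᵖ1-^ₚ p) Sₚ.refl))))

    ^ₚ-char-coeff-zero : ∀ f → (f ^ₚ p) 0 ≈ f 0 ^ p
    ^ₚ-char-coeff-zero f = begin
      (f ^ₚ p) 0                                   ≈⟨ ^ₚ-char-split f 0 ⟩
      (f 0 ^ p) * 1# + (Tᵖ p *ₚ (tailₚ f ^ₚ p)) 0  ≈⟨ +-cong (*-identityʳ _) (Tᵖ-*ₚ-coeff-< p (tailₚ f ^ₚ p) 0 p>0) ⟩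
      f 0 ^ p + 0#                                 ≈⟨ +-identityʳ _ ⟩
      f 0 ^ p                                      ∎

    ^ₚ-char-coeff-< : ∀ f {s} → 0 < s → s < p → (f ^ₚ p) s ≈ 0#
    ^ₚ-char-coeff-< f {s} s>0 s<p = begin
      (f ^ₚ p) s                                        ≈⟨ ^ₚ-char-split f s ⟩
      ((f 0 ^ p) ·ₚ 1ₚ) s + (Tᵖ p *ₚ (tailₚ f ^ₚ p)) s  ≈⟨ +-cong (·ₚ1ₚ-coeff-pos _ s s>0)
                                                                 (Tᵖ-*ₚ-coeff-< p (tailₚ f ^ₚ p) s s<p) ⟩
      0# + 0#                                           ≈⟨ +-identityʳ 0# ⟩
      0#                                                ∎

    ^ₚ-char-coeff-+ : ∀ f u → (f ^ₚ p) (p ℕ.+ u) ≈ (tailₚ f ^ₚ p) u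
    ^ₚ-char-coeff-+ f u = begin
      (f ^ₚ p) (p ℕ.+ u)                                                ≈⟨ ^ₚ-char-split f _ ⟩
      ((f 0 ^ p) ·ₚ 1ₚ) (p ℕ.+ u) + (Tᵖ p *ₚ (tailₚ f ^ₚ p)) (p ℕ.+ u)  ≈⟨ +-cong (·ₚ1ₚ-coeff-pos _ _ p+u>0)
                                                                                   (Tᵖ-*ₚ-coeff-+ p (tailₚ f ^ₚ p) u) ⟩
      0# + (tailₚ f ^ₚ p) u                                             ≈⟨ +-identityˡ _ ⟩
      (tailₚ f ^ₚ p) u                                                  ∎
      where p+u>0 = ℕ.<-≤-trans p>0 (ℕ.m≤m+n p u)

    ^ₚ-char-coeff-* : ∀ f j → (f ^ₚ p) (j ℕ.* p) ≈ f j ^ p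
    ^ₚ-char-coeff-* f zero = ^ₚ-char-coeff-zero f
    ^ₚ-char-coeff-* f (suc j) = trans (^ₚ-char-coeff-+ f (j ℕ.* p)) (^ₚ-char-coeff-* (tailₚ f) j)

    ^ₚ-char-coeff-*+ : ∀ f j {s} → 0 < s → s < p → (f ^ₚ p) (j ℕ.* p ℕ.+ s) ≈ 0#
    ^ₚ-char-coeff-*+ f zero s>0 s<p = ^ₚ-char-coeff-< f s>0 s<p
    ^ₚ-char-coeff-*+ f (suc j) {s} s>0 s<p = begin
      (f ^ₚ p) (p ℕ.+ j ℕ.* p ℕ.+ s)    ≡⟨ ≡.cong (f ^ₚ p) (ℕ.+-assoc p (j ℕ.* p) s) ⟩
      (f ^ₚ p) (p ℕ.+ (j ℕ.* p ℕ.+ s))  ≈⟨ ^ₚ-char-coeff-+ f _ ⟩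
      (tailₚ f ^ₚ p) (j ℕ.* p ℕ.+ s)    ≈⟨ ^ₚ-char-coeff-*+ (tailₚ f) j s>0 s<p ⟩
      0#                                ∎

    ^ₚ-char-coeff-∤ : ∀ f {t} → ¬ p ∣ t → (f ^ₚ p) t ≈ 0#
    ^ₚ-char-coeff-∤ f {t} p∤t =
      ≡.subst (λ u → (f ^ₚ p) u ≈ 0#) (≡.sym t≡) (^ₚ-char-coeff-*+ f (t / p) t%p>0 (m%n<n t p))
      where
      t≡ : t ≡ t / p ℕ.* p ℕ.+ t % p
      t≡ = ≡.trans (m≡m%n+[m/n]*n t p) (ℕ.+-comm (t % p) _)
      t%p>0 : 0 < t % p
      t%p>0 = ℕ.n≢0⇒n>0 λ t%p≡0 → p∤t (m%n≡0⇒n∣m t p t%p≡0)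

    ^ₚ-char^-suc : ∀ k f → (f ^ₚ (p ℕ.^ suc k)) ≈ₚ ((f ^ₚ (p ℕ.^ k)) ^ₚ p)
    ^ₚ-char^-suc k f = ≡.subst (λ e → (f ^ₚ e) ≈ₚ ((f ^ₚ (p ℕ.^ k)) ^ₚ p)) (ℕ.*-comm (p ℕ.^ k) p)
                         (Sₚ.sym (^ₚ-assocʳ f (p ℕ.^ k) p))

    ^ₚ-char^-coeff-* : ∀ k f j → (f ^ₚ (p ℕ.^ k)) (j ℕ.* p ℕ.^ k) ≈ f j ^ (p ℕ.^ k)
    ^ₚ-char^-coeff-* zero f j = begin
      (f ^ₚ 1) (j ℕ.* 1) ≡⟨ ≡.cong (f ^ₚ 1) (ℕ.*-identityʳ j) ⟩
      (f *ₚ 1ₚ) j        ≈⟨ *ₚ-comm f 1ₚ j ⟩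
      (1ₚ *ₚ f) j        ≈⟨ *ₚ-identityˡ f j ⟩
      f j                ≈⟨ *-identityʳ (f j) ⟨
      f j ^ 1            ∎
    ^ₚ-char^-coeff-* (suc k) f j = begin
      (f ^ₚ (p ℕ.* P)) (j ℕ.* (p ℕ.* P)) ≈⟨ ^ₚ-char^-suc k f _ ⟩
      ((f ^ₚ P) ^ₚ p) (j ℕ.* (p ℕ.* P))  ≡⟨ ≡.cong ((f ^ₚ P) ^ₚ p) j*[p*P]≡[j*P]*p ⟩
      ((f ^ₚ P) ^ₚ p) (j ℕ.* P ℕ.* p)    ≈⟨ ^ₚ-char-coeff-* (f ^ₚ P) (j ℕ.* P) ⟩
      (f ^ₚ P) (j ℕ.* P) ^ p             ≈⟨ ^-congˡ p (^ₚ-char^-coeff-* k f j) ⟩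
      (f j ^ P) ^ p                      ≈⟨ ^-assocʳ (f j) P p ⟩
      f j ^ (P ℕ.* p)                    ≡⟨ ≡.cong (f j ^_) (ℕ.*-comm P p) ⟩
      f j ^ (p ℕ.* P)                    ∎
      where
      P = p ℕ.^ k
      j*[p*P]≡[j*P]*p : j ℕ.* (p ℕ.* P) ≡ j ℕ.* P ℕ.* p
      j*[p*P]≡[j*P]*p = ≡.trans (≡.cong (j ℕ.*_) (ℕ.*-comm p P)) (≡.sym (ℕ.*-assoc j P p))

    ^ₚ-char^-coeff-∤ : ∀ k f {t} → ¬ p ℕ.^ k ∣ t → (f ^ₚ (p ℕ.^ k)) t ≈ 0#
    ^ₚ-char^-coeff-∤ zero f {t} 1∤t = contradiction (1∣ t) 1∤t
    ^ₚ-char^-coeff-∤ (suc k) f {t} pP∤t with p ∣? t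
    ... | no p∤t = trans (^ₚ-char^-suc k f t) (^ₚ-char-coeff-∤ (f ^ₚ P) p∤t)
      where P = p ℕ.^ k
    ... | yes (divides d ≡.refl) = begin
      (f ^ₚ (p ℕ.* P)) (d ℕ.* p)   ≈⟨ ^ₚ-char^-suc k f _ ⟩
      ((f ^ₚ P) ^ₚ p) (d ℕ.* p)    ≈⟨ ^ₚ-char-coeff-* (f ^ₚ P) d ⟩
      (f ^ₚ P) d ^ p               ≈⟨ ^-congˡ p (^ₚ-char^-coeff-∤ k f P∤d) ⟩
      0# ^ p                       ≡⟨ ≡.cong (0# ^_) (ℕ.suc-pred p) ⟨
      0# * 0# ^ ℕ.pred p           ≈⟨ zeroˡ _ ⟩
      0#                           ∎
      where
      P = p ℕ.^ k
      P∤d : ¬ P ∣ d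
      P∤d P∣d = pP∤t (≡.subst (_∣ d ℕ.* p) (ℕ.*-comm P p) (*-monoˡ-∣ p P∣d))

module _ {a ℓ : Level} (M : CommutativeMonoid a ℓ) where
  open CommutativeMonoid M
  open import Algebra.Properties.CommutativeMonoid.Sum M using (sum; sum-remove; sum-cong-≋)
  open import Algebra.Properties.CommutativeSemigroup commutativeSemigroup using (x∙yz≈y∙xz)
  open import Relation.Binary.Reasoning.Setoid setoid

  sum-exchange : ∀ {n} (v w : Fin n → Carrier) z → (∀ i → i ≢ z → v i ≈ w i) → w z ∙ sum v ≈ v z ∙ sum w
  sum-exchange {suc n} v w z v≈w = begin
    w z ∙ sum v                              ≈⟨ ∙-congˡ (sum-remove {i = z} v) ⟩
    w z ∙ (v z ∙ sum (v ∘punchIn))           ≈⟨ x∙yz≈y∙xz _ _ _ ⟩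
    v z ∙ (w z ∙ sum (v ∘punchIn))           ≈⟨ ∙-congˡ (∙-congˡ (sum-cong-≋ λ i → v≈w _ (Fin.punchInᵢ≢i z i))) ⟩
    v z ∙ (w z ∙ sum (w ∘punchIn))           ≈⟨ ∙-congˡ (sum-remove {i = z} w) ⟨
    v z ∙ sum w                              ∎
    where
    _∘punchIn : (Fin (suc n) → Carrier) → Fin n → Carrier
    (u ∘punchIn) i = u (punchIn z i)

module FiniteField {c ℓ : Level} {F : CommutativeRing c ℓ} {q : ℕ} (isFF : IsFiniteFieldOfSize F q) where
  open CommutativeRing F hiding (zero)
  open IsFiniteFieldOfSize isFF
  open import Algebra.Properties.Semiring.Mult semiring using (_×_; ×1-homo-*)
  open import Algebra.Properties.Semiring.Exp semiring using (_^_; ^-congˡ; ^-assocʳ)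
  open import Algebra.Properties.CommutativeMonoid.Sum +-commutativeMonoid as Σ using ()
  open import Algebra.Properties.CommutativeMonoid.Sum *-commutativeMonoid as Π using ()
  open import Relation.Binary.Reasoning.Setoid setoid

  index : Carrier → Fin q
  index x = proj₁ (enum-surj x)

  enum-index : ∀ x → enum (index x) ≈ x
  enum-index x = proj₂ (enum-surj x)

  _≈?_ : Decidable _≈_
  x ≈? y with index x Fin.≟ index y
  ... | yes i≡j = yes (trans (sym (enum-index x)) (trans (reflexive (≡.cong enum i≡j)) (enum-index y)))
  ... | no i≢j = no λ x≈y → i≢j (enum-inj _ _ (trans (enum-index x) (trans x≈y (sym (enum-index y)))))

  reindex : (f g : Carrier → Carrier) → (∀ {x y} → x ≈ y → f x ≈ f y) → (∀ {x y} → x ≈ y → g x ≈ g y) →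
            (∀ x → f (g x) ≈ x) → (∀ x → g (f x) ≈ x) → Permutation q q
  reindex f g f-cong g-cong f∘g g∘f = permutation (λ i → index (f (enum i))) (λ i → index (g (enum i)))
    (λ i → enum-inj _ _ (trans (enum-index _) (trans (f-cong (enum-index _)) (f∘g (enum i)))))
    (λ i → enum-inj _ _ (trans (enum-index _) (trans (g-cong (enum-index _)) (g∘f (enum i)))))

  private
    +-cancelˡ-≈ : ∀ {a b} → a + b ≈ a → b ≈ 0#
    +-cancelˡ-≈ {a} {b} a+b≈a = begin
      b                ≈⟨ +-identityˡ b ⟨
      0# + b           ≈⟨ +-congʳ (-‿inverseˡ a) ⟨
      (- a + a) + b    ≈⟨ +-assoc _ _ _ ⟩
      - a + (a + b)    ≈⟨ +-congˡ a+b≈a ⟩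
      - a + a          ≈⟨ -‿inverseˡ a ⟩
      0#               ∎

  ≉0∧*≈0⇒≈0 : ∀ {a b} → ¬ a ≈ 0# → a * b ≈ 0# → b ≈ 0#
  ≉0∧*≈0⇒≈0 {a} {b} a≉0 ab≈0 with inverse a a≉0
  ... | a⁻¹ , aa⁻¹≈1 = begin
    b               ≈⟨ *-identityˡ b ⟨
    1# * b          ≈⟨ *-congʳ (trans (sym aa⁻¹≈1) (*-comm a a⁻¹)) ⟩
    a⁻¹ * a * b     ≈⟨ *-assoc _ _ _ ⟩
    a⁻¹ * (a * b)   ≈⟨ *-congˡ ab≈0 ⟩
    a⁻¹ * 0#        ≈⟨ zeroʳ _ ⟩
    0#              ∎

  *-cancelʳ-≉0 : ∀ {a b c} → ¬ c ≈ 0# → a * c ≈ b * c → a ≈ b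
  *-cancelʳ-≉0 {a} {b} {c} c≉0 ac≈bc with inverse c c≉0
  ... | c⁻¹ , cc⁻¹≈1 = begin
    a               ≈⟨ *-identityʳ a ⟨
    a * 1#          ≈⟨ *-congˡ cc⁻¹≈1 ⟨
    a * (c * c⁻¹)   ≈⟨ *-assoc _ _ _ ⟨
    a * c * c⁻¹     ≈⟨ *-congʳ ac≈bc ⟩
    b * c * c⁻¹     ≈⟨ *-assoc _ _ _ ⟩
    b * (c * c⁻¹)   ≈⟨ *-congˡ cc⁻¹≈1 ⟩
    b * 1#          ≈⟨ *-identityʳ b ⟩
    b               ∎

  -- Translating by 1 permutes the field, so adding q copies of 1 to the sum of all elements leaves it unchanged.
  size×1≈0 : q × 1# ≈ 0#
  size×1≈0 = +-cancelˡ-≈ (begin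
    Σ.sum enum + q × 1#                   ≈⟨ +-congˡ (Σ.sum-replicate q) ⟨
    Σ.sum enum + Σ.sum {q} (λ _ → 1#)     ≈⟨ Σ.∑-distrib-+ enum (λ _ → 1#) ⟨
    Σ.sum (λ i → enum i + 1#)             ≈⟨ Σ.sum-cong-≋ (λ i → sym (enum-index (enum i + 1#))) ⟩
    Σ.sum (λ i → enum (π ⟨$⟩ʳ i))         ≈⟨ Σ.sum-permute enum π ⟨
    Σ.sum enum                            ∎)
    where
    π = reindex (_+ 1#) (_+ - 1#) +-congʳ +-congʳ
      (λ x → trans (+-assoc _ _ _) (trans (+-congˡ (-‿inverseˡ 1#)) (+-identityʳ x)))
      (λ x → trans (+-assoc _ _ _) (trans (+-congˡ (-‿inverseʳ 1#)) (+-identityʳ x)))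

  characteristic : ∀ p e → q ≡ p ℕ.^ e → p × 1# ≈ 0#
  characteristic p e ≡.refl = descend e size×1≈0
    where
    descend : ∀ k → (p ℕ.^ k) × 1# ≈ 0# → p × 1# ≈ 0#
    descend zero 1≈0 = contradiction (trans (sym (+-identityʳ 1#)) 1≈0) nontrivial
    descend (suc k) p^[1+k]≈0 with (p × 1#) ≈? 0#
    ... | yes p≈0 = p≈0
    ... | no p≉0 = descend k (≉0∧*≈0⇒≈0 p≉0 (trans (sym (×1-homo-* p (p ℕ.^ k))) p^[1+k]≈0))

  zero↦one : Carrier → Carrier
  zero↦one x with x ≈? 0#
  ... | yes _ = 1#
  ... | no _ = x

  zero↦one-≉0 : ∀ x → ¬ zero↦one x ≈ 0#
  zero↦one-≉0 x with x ≈? 0#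
  ... | yes _ = nontrivial
  ... | no x≉0 = x≉0

  zero↦one-≈0 : ∀ {x} → x ≈ 0# → zero↦one x ≈ 1#
  zero↦one-≈0 {x} x≈0 with x ≈? 0#
  ... | yes _ = refl
  ... | no x≉0 = contradiction x≈0 x≉0

  zero↦one-≉0-id : ∀ {x} → ¬ x ≈ 0# → zero↦one x ≈ x
  zero↦one-≉0-id {x} x≉0 with x ≈? 0#
  ... | yes x≈0 = contradiction x≈0 x≉0
  ... | no _ = refl

  zero↦one-cong : ∀ {x y} → x ≈ y → zero↦one x ≈ zero↦one y
  zero↦one-cong {x} {y} x≈y with x ≈? 0# | y ≈? 0#
  ... | yes _   | yes _   = refl
  ... | yes x≈0 | no y≉0  = contradiction (trans (sym x≈y) x≈0) y≉0
  ... | no x≉0  | yes y≈0 = contradiction (trans x≈y y≈0) x≉0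
  ... | no _    | no _    = x≈y

  ∏-≉0 : ∀ {n} (w : Fin n → Carrier) → (∀ i → ¬ w i ≈ 0#) → ¬ Π.sum w ≈ 0#
  ∏-≉0 {zero} w _ = nontrivial
  ∏-≉0 {suc n} w w≉0 ∏w≈0 = ∏-≉0 (λ i → w (Fin.suc i)) (λ i → w≉0 (Fin.suc i)) (≉0∧*≈0⇒≈0 (w≉0 Fin.zero) ∏w≈0)

  -- Multiplication by a ≉ 0 permutes the field and fixes 0; with 0 replaced by 1 the product P of all
  -- elements is nonzero and satisfies a ^ q * P ≈ a * P.
  fermat : ∀ a → a ^ q ≈ a
  fermat a with a ≈? 0#
  ... | yes a≈0 = begin
    a ^ q                    ≡⟨ ≡.cong (a ^_) (ℕ.suc-pred q) ⟨
    a * a ^ ℕ.pred q         ≈⟨ trans (*-congʳ a≈0) (zeroˡ _) ⟩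
    0#                       ≈⟨ a≈0 ⟨
    a                        ∎
    where instance _ = Fin.nonZeroIndex (index 0#)
  ... | no a≉0 = *-cancelʳ-≉0 (∏-≉0 u (λ i → zero↦one-≉0 (enum i))) (begin
    a ^ q * Π.sum u                                 ≈⟨ *-congʳ (Π.sum-replicate q) ⟨
    Π.sum {q} (λ _ → a) * Π.sum u                   ≈⟨ Π.∑-distrib-+ (λ _ → a) u ⟨
    Π.sum v                                         ≈⟨ *-identityˡ _ ⟨
    1# * Π.sum v                      ≈⟨ *-congʳ (zero↦one-≈0 (trans (*-congˡ (enum-index 0#)) (zeroʳ a))) ⟨
    w z * Π.sum v                     ≈⟨ sum-exchange *-commutativeMonoid v w z v≈w ⟩
    v z * Π.sum w                     ≈⟨ *-congʳ (trans (*-congˡ (zero↦one-≈0 (enum-index 0#))) (*-identityʳ a)) ⟩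
    a * Π.sum w                       ≈⟨ *-congˡ (Π.sum-cong-≋ λ i → zero↦one-cong (enum-index (a * enum i))) ⟨
    a * Π.sum (λ i → u (π ⟨$⟩ʳ i))                  ≈⟨ *-congˡ (Π.sum-permute u π) ⟨
    a * Π.sum u                                     ∎)
    where
    u v w : Fin q → Carrier
    u i = zero↦one (enum i)
    v i = a * u i
    w i = zero↦one (a * enum i)
    z = index 0#
    a⁻¹ = proj₁ (inverse a a≉0)
    aa⁻¹≈1 = proj₂ (inverse a a≉0)
    π = reindex (a *_) (a⁻¹ *_) *-congˡ *-congˡ
      (λ x → trans (sym (*-assoc _ _ _)) (trans (*-congʳ aa⁻¹≈1) (*-identityˡ x)))
      (λ x → trans (sym (*-assoc _ _ _)) (trans (*-congʳ (trans (*-comm a⁻¹ a) aa⁻¹≈1)) (*-identityˡ x)))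
    enum-≉0 : ∀ i → i ≢ z → ¬ enum i ≈ 0#
    enum-≉0 i i≢z eᵢ≈0 = i≢z (enum-inj i z (trans eᵢ≈0 (sym (enum-index 0#))))
    v≈w : ∀ i → i ≢ z → v i ≈ w i
    v≈w i i≢z = trans (*-congˡ (zero↦one-≉0-id (enum-≉0 i i≢z)))
                      (sym (zero↦one-≉0-id λ aeᵢ≈0 → enum-≉0 i i≢z (≉0∧*≈0⇒≈0 a≉0 aeᵢ≈0)))

  fermat^ : ∀ m a → a ^ (q ℕ.^ m) ≈ a
  fermat^ zero a = *-identityʳ a
  fermat^ (suc m) a = begin
    a ^ (q ℕ.* q ℕ.^ m)      ≈⟨ ^-assocʳ a q (q ℕ.^ m) ⟨
    (a ^ q) ^ (q ℕ.^ m)      ≈⟨ ^-congˡ (q ℕ.^ m) (fermat a) ⟩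
    a ^ (q ℕ.^ m)            ≈⟨ fermat^ m a ⟩
    a                        ∎

module DigitLayers {c ℓ : Level} (R : CommutativeRing c ℓ) {q : ℕ} (1<q : 1 < q) (x : PowerSeries.PS R) (r : ℕ) where
  open CommutativeRing R
  open PowerSeries R
  open PowerSeriesSemiring R
  open PowerSeriesCoefficients R
  open RangeSums R
  open import Relation.Binary.Reasoning.Setoid setoid

  private
    instance
      q≢0 : NonZero q
      q≢0 = ℕ.>-nonZero (ℕ.<-trans ℕ.z<s 1<q)

  layer : ℕ → ℕ → PS
  layer i j = Tᵖ (j ℕ.* q ℕ.^ i) *ₚ φ q (j ℕ.* q ℕ.^ i ℕ.+ r) x

  module _ (i j : ℕ) (r<q^i : r < q ℕ.^ i) (1≤j : 1 ≤ j) (j<q : j < q) where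
    private
      A = q ℕ.^ i
      instance _ = ℕ.m^n≢0 q i

    ndigits-layer : ndigits q (j ℕ.* A ℕ.+ r) ≡ suc i
    ndigits-layer = ndigits≡suc 1<q
      (ℕ.≤-trans (ℕ.m≤n*m A j {{ℕ.>-nonZero 1≤j}}) (ℕ.m≤m+n (j ℕ.* A) r))
      (ℕ.<-≤-trans (ℕ.+-monoʳ-< (j ℕ.* A) r<q^i)
                   (ℕ.≤-trans (ℕ.≤-reflexive (ℕ.+-comm (j ℕ.* A) A)) (ℕ.*-monoˡ-≤ A j<q)))

    layer-coeff : ∀ s → layer i j (j ℕ.* A ℕ.+ s) ≈ 𝟙 (q ℕ.* A ∣? s) * x (j ℕ.* A ℕ.+ s ℕ.+ r)
    layer-coeff s = begin
      layer i j (j ℕ.* A ℕ.+ s)                                            ≈⟨ Tᵖ-*ₚ-coeff-+ (j ℕ.* A) φₙ s ⟩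
      φ q (j ℕ.* A ℕ.+ r) x s                                              ≈⟨ φ-coeff q (j ℕ.* A ℕ.+ r) x s ⟩
      𝟙 (q ℕ.^ ndigits q (j ℕ.* A ℕ.+ r) ∣? s) * x (s ℕ.+ (j ℕ.* A ℕ.+ r)) ≡⟨ ≡.cong₂ (λ d u → 𝟙 (q ℕ.^ d ∣? s) * x u)
                                                                                ndigits-layer s+[jA+r]≡jA+s+r ⟩
      𝟙 (q ℕ.* A ∣? s) * x (j ℕ.* A ℕ.+ s ℕ.+ r)                           ∎
      where
      open import Algebra.Properties.CommutativeSemigroup ℕ.+-commutativeSemigroup using (x∙yz≈y∙xz)
      φₙ = φ q (j ℕ.* A ℕ.+ r) x
      s+[jA+r]≡jA+s+r : s ℕ.+ (j ℕ.* A ℕ.+ r) ≡ j ℕ.* A ℕ.+ s ℕ.+ r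
      s+[jA+r]≡jA+s+r = ≡.trans (x∙yz≈y∙xz s (j ℕ.* A) r) (≡.sym (ℕ.+-assoc (j ℕ.* A) s r))

    layer-coeff-hit : ∀ l → layer i j (j ℕ.* A ℕ.+ l ℕ.* (q ℕ.* A)) ≈ x (j ℕ.* A ℕ.+ l ℕ.* (q ℕ.* A) ℕ.+ r)
    layer-coeff-hit l = trans (layer-coeff (l ℕ.* (q ℕ.* A)))
      (trans (*-congʳ (𝟙-yes (q ℕ.* A ∣? l ℕ.* (q ℕ.* A)) (n∣m*n l))) (*-identityˡ _))

    layer-coeff-miss : ∀ t → (∀ l → t ≢ j ℕ.* A ℕ.+ l ℕ.* (q ℕ.* A)) → layer i j t ≈ 0#
    layer-coeff-miss t t≢ with j ℕ.* A ℕ.≤? t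
    ... | no jA≰t = Tᵖ-*ₚ-coeff-< (j ℕ.* A) (φ q (j ℕ.* A ℕ.+ r) x) t (ℕ.≰⇒> jA≰t)
    ... | yes jA≤t with ℕ.m≤n⇒∃[o]m+o≡n jA≤t
    ...   | s , ≡.refl = trans (layer-coeff s) (trans (*-congʳ (𝟙-no (q ℕ.* A ∣? s) qA∤s)) (zeroˡ _))
      where
      qA∤s : ¬ q ℕ.* A ∣ s
      qA∤s (divides l s≡l*qA) = t≢ l (≡.cong (j ℕ.* A ℕ.+_) s≡l*qA)

  -- Exactly one j ∈ [1, q) can match t, namely the digit (t / q^i) % q, and only when it is nonzero.
  layer-sum-coeff : ∀ {i} → r < q ℕ.^ i → ∀ t →
    ΣR (map (λ j → layer i j t) (range 1 q)) + 𝟙 (q ℕ.^ suc i ∣? t) * x (t ℕ.+ r) ≈ 𝟙 (q ℕ.^ i ∣? t) * x (t ℕ.+ r)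
  layer-sum-coeff {i} r<A t with q ℕ.^ i ∣? t | q ℕ.^ suc i ∣? t
  ... | no A∤t | yes qA∣t = contradiction (∣-trans (n∣m*n q) qA∣t) A∤t
  ... | no A∤t | no _ = begin
    ΣR (map (λ j → layer i j t) (range 1 q)) + 0# * x (t ℕ.+ r)  ≈⟨ +-cong (ΣR-range-zero _ 1 q miss) (zeroˡ _) ⟩
    0# + 0#                                                       ≈⟨ +-identityʳ 0# ⟩
    0#                                                            ≈⟨ zeroˡ _ ⟨
    0# * x (t ℕ.+ r)                                              ∎
    where
    instance _ = ℕ.m^n≢0 q i
    miss : ∀ j → 1 ≤ j → j < q → layer i j t ≈ 0#
    miss j 1≤j j<q = layer-coeff-miss i j r<A 1≤j j<q t λ l t≡ →
      A∤t (≡.subst (q ℕ.^ i ∣_) (≡.sym t≡) (∣-digitForm j l))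
  ... | yes (divides u t≡uA) | yes qA∣t = trans (+-congʳ (ΣR-range-zero _ 1 q miss)) (+-identityˡ _)
    where
    instance _ = ℕ.m^n≢0 q i
    u%q≡0 : u % q ≡ 0
    u%q≡0 = n∣m⇒m%n≡0 u q (*-cancelʳ-∣ (q ℕ.^ i) (≡.subst (_ ∣_) t≡uA qA∣t))
    miss : ∀ j → 1 ≤ j → j < q → layer i j t ≈ 0#
    miss j 1≤j j<q = layer-coeff-miss i j r<A 1≤j j<q t λ l t≡ →
      ℕ.<-irrefl (≡.trans (≡.sym u%q≡0) (digitForm⇒%≡ {l = l} j<q (≡.trans (≡.sym t≡uA) t≡))) 1≤j
  ... | yes (divides u t≡uA) | no qA∤t = begin
    ΣR (map (λ j → layer i j t) (range 1 q)) + 0# * x (t ℕ.+ r)  ≈⟨ +-cong (ΣR-range-single _ 1 q d 1≤d (m%n<n u q) miss)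
                                                                            (zeroˡ _) ⟩
    layer i d t + 0#                                              ≈⟨ +-identityʳ _ ⟩
    layer i d t                                                   ≈⟨ hit ⟩
    x (t ℕ.+ r)                                                   ≈⟨ *-identityˡ _ ⟨
    1# * x (t ℕ.+ r)                                              ∎
    where
    instance _ = ℕ.m^n≢0 q i
    d = u % q
    1≤d : 1 ≤ d
    1≤d = ℕ.n≢0⇒n>0 λ d≡0 → qA∤t (≡.subst (_ ∣_) (≡.sym t≡uA) (*-monoˡ-∣ (q ℕ.^ i) (m%n≡0⇒n∣m u q d≡0)))
    t≡ : t ≡ d ℕ.* q ℕ.^ i ℕ.+ u / q ℕ.* (q ℕ.* q ℕ.^ i)
    t≡ = ≡.trans t≡uA (*≡digitForm u)
    hit : layer i d t ≈ x (t ℕ.+ r)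
    hit = ≡.subst (λ t′ → layer i d t′ ≈ x (t′ ℕ.+ r)) (≡.sym t≡) (layer-coeff-hit i d r<A 1≤d (m%n<n u q) (u / q))
    miss : ∀ j → 1 ≤ j → j < q → j ≢ d → layer i j t ≈ 0#
    miss j 1≤j j<q j≢d = layer-coeff-miss i j r<A 1≤j j<q t λ l t≡′ →
      j≢d (≡.sym (digitForm⇒%≡ {l = l} j<q (≡.trans (≡.sym t≡uA) t≡′)))

  φ-sub-layers-coeff : ∀ {k m} → ndigits q r ≡ k → r < q ℕ.^ k → k ≤ m → ∀ t →
    (φ q r x -ₚ ΣPS (concatMap (λ i → map (layer i) (range 1 q)) (range k m))) t ≈ 𝟙 (q ℕ.^ m ∣? t) * x (t ℕ.+ r)
  φ-sub-layers-coeff {k} {m} ndigits≡k r<q^k k≤m t = sym (x≈z//y (d m) (ΣPS layers t) (φ q r x t) (begin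
    d m + ΣPS layers t                     ≈⟨ +-comm _ _ ⟩
    ΣPS layers t + d m                     ≈⟨ +-congʳ (ΣPS-coeff-concatMap _ (range k m) t) ⟩
    ΣR (map (λ i → ΣPS (map (layer i) (range 1 q)) t) (range k m)) + d m
                                           ≡⟨ ≡.cong (λ s → ΣR s + d m)
                                                (map-cong (λ i → ΣPS-coeff-map (layer i) (range 1 q) t) (range k m)) ⟩
    ΣR (map layerSum (range k m)) + d m    ≈⟨ ΣR-telescope layerSum d k m k≤m step ⟩
    d k                                    ≈⟨ ≡.subst (λ e → φ q r x t ≈ 𝟙 (q ℕ.^ e ∣? t) * x (t ℕ.+ r)) ndigits≡k
                                                (φ-coeff q r x t) ⟨
    φ q r x t                              ∎))
    where
    open import Algebra.Properties.Quasigroup (Algebra.Properties.Group.quasigroup +-group) using (x≈z//y)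
    layers = concatMap (λ i → map (layer i) (range 1 q)) (range k m)
    d : ℕ → Carrier
    d i = 𝟙 (q ℕ.^ i ∣? t) * x (t ℕ.+ r)
    layerSum : ℕ → Carrier
    layerSum i = ΣR (map (λ j → layer i j t) (range 1 q))
    step : ∀ i → k ≤ i → i < m → layerSum i + d (suc i) ≈ d i
    step i k≤i _ = layer-sum-coeff {i} (ℕ.<-≤-trans r<q^k (ℕ.^-monoʳ-≤ q k≤i)) t

module _ {c ℓ : Level} {F : CommutativeRing c ℓ} {q : ℕ} (isFF : IsFiniteFieldOfSize F q)
         {p e : ℕ} (p-prime : Prime p) (q≡p^e : q ≡ p ℕ.^ e) where
  open CommutativeRing F
  open PowerSeries F
  open PowerSeriesCoefficients F
  open PowerSeriesFrobenius F
  open FiniteField isFF using (characteristic; fermat^)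
  open import Algebra.Properties.Semiring.Exp semiring using (_^_)
  open import Relation.Binary.Reasoning.Setoid setoid

  private
    q^m≡p^[e*m] : ∀ m → q ℕ.^ m ≡ p ℕ.^ (e ℕ.* m)
    q^m≡p^[e*m] m = ≡.trans (≡.cong (ℕ._^ m) q≡p^e) (ℕ.^-*-assoc p e m)

    char-p = characteristic p e q≡p^e

  ^ₚ-size^-coeff-* : ∀ m f j → (f ^ₚ (q ℕ.^ m)) (j ℕ.* q ℕ.^ m) ≈ f j
  ^ₚ-size^-coeff-* m f j = begin
    (f ^ₚ (q ℕ.^ m)) (j ℕ.* q ℕ.^ m)                   ≡⟨ ≡.cong (λ Q → (f ^ₚ Q) (j ℕ.* Q)) (q^m≡p^[e*m] m) ⟩
    (f ^ₚ (p ℕ.^ (e ℕ.* m))) (j ℕ.* p ℕ.^ (e ℕ.* m))   ≈⟨ ^ₚ-char^-coeff-* p-prime char-p (e ℕ.* m) f j ⟩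
    f j ^ (p ℕ.^ (e ℕ.* m))                            ≡⟨ ≡.cong (f j ^_) (q^m≡p^[e*m] m) ⟨
    f j ^ (q ℕ.^ m)                                    ≈⟨ fermat^ m (f j) ⟩
    f j                                                ∎

  ^ₚ-size^-coeff-∤ : ∀ m f {t} → ¬ q ℕ.^ m ∣ t → (f ^ₚ (q ℕ.^ m)) t ≈ 0#
  ^ₚ-size^-coeff-∤ m f {t} = ≡.subst (λ Q → ¬ Q ∣ t → (f ^ₚ Q) t ≈ 0#) (≡.sym (q^m≡p^[e*m] m))
                               (^ₚ-char^-coeff-∤ p-prime char-p (e ℕ.* m) f)

  Δ-^ₚ-coeff : ∀ r m x t → (Δ q r m x ^ₚ (q ℕ.^ m)) t ≈ 𝟙 (q ℕ.^ m ∣? t) * x (t ℕ.+ r)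
  Δ-^ₚ-coeff r m x t with q ℕ.^ m ∣? t
  ... | yes (divides j ≡.refl) = trans (^ₚ-size^-coeff-* m (Δ q r m x) j) (sym (*-identityˡ _))
  ... | no q^m∤t = trans (^ₚ-size^-coeff-∤ m (Δ q r m x) q^m∤t) (sym (zeroˡ _))

open import Data.Nat using (_^_; _+_; _*_)
open import Data.Product using (_×_)

mainTheorem12 : {c ℓ : Level} (q : ℕ) → IsPrimePower q →
    (F : CommutativeRing c ℓ) → IsFiniteFieldOfSize F q →
    (m k r : ℕ) →
    ((1 ≤ k × q ^ (k ∸ 1) ≤ r × r < q ^ k × q ^ k ≤ q ^ m) ⊎ (r ≡ 0 × k ≡ 0)) →
    let open PowerSeries F in
    (x : PS) →
      (Δ q r m x ^ₚ (q ^ m))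
        ≈ₚ (φ q r x -ₚ ΣPS (concatMap (λ i → map (λ j →
                 Tᵖ (j * q ^ i) *ₚ φ q (j * q ^ i + r) x)
               (range 1 q)) (range k m)))
mainTheorem12 q q-primePower@(_ , e , p-prime , _ , q≡p^e) F isFF m k r hypothesis x t
  with hypothesis⇒ndigits (primePower>1 q-primePower) hypothesis
... | ndigits≡k , r<q^k , k≤m =
  trans (Δ-^ₚ-coeff isFF {e = e} p-prime q≡p^e r m x t)
        (sym (DigitLayers.φ-sub-layers-coeff F (primePower>1 q-primePower) x r ndigits≡k r<q^k k≤m t))
  where open CommutativeRing F using (trans; sym)
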